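{- For every integer $d\geq 2$, \[\kappa_d\geq \begin{cases} 2^d/(d+1) & \text{if } d \text{ is odd};\\ 2^{d-1}/d & \text{if } d \text{ is even.}\end{cases}\]
   Context: For an integer $d\geq 2$, consider a finite simple $(d-1)$-uniform hypergraph $H$ (no hyperedge appears twice) in which each hyperedge receives exactly one of $d$ colors $c_1,\ldots,c_d$. Let $C_i$ be the number of hyperedges of color $c_i$, and let $T$ be the number of rainbow $K^{(d-1)}_d$'s in $H$, i.e. the number of $d$-subsets of $V(H)$ all of whose $d$ subsets of size $d-1$ are hyperedges of $H$ and these $d$ hyperedges have $d$ distinct colors. Define $\kappa_d$ to be the supremum of the ratio $T^{d-1}/(C_1C_2\cdots C_d)$ over all such colored hypergraphs (with all $C_i>0$). -}

module Defs where

open import Data.Nat using (ℕ; zero; suc; _+_; _*_; _∸_; _^_; _≡ᵇ_; _%_)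
open import Data.Bool using (Bool; true; false; _∧_; _∨_; not; if_then_else_)
open import Data.Fin using (Fin; toℕ)
open import Data.Vec using (Vec; []; _∷_; lookup)
open import Data.List using (List; []; _∷_; _++_; map; filter; length; allFin; foldr)
open import Data.Nat.ListAction using (product)
open import Data.Maybe using (Maybe; just; nothing)
open import Data.Fin.Subset using (Subset; ∣_∣; _-_)
open import Relation.Nullary.Decidable using (T?)

allᵇ : ∀ {A : Set} → (A → Bool) → List A → Bool
allᵇ p = foldr (λ x b → p x ∧ b) true

allSubsets : (n : ℕ) → List (Subset n)
allSubsets zero    = [] ∷ []
allSubsets (suc n) = map (false ∷_) (allSubsets n) ++ map (true ∷_) (allSubsets n)

-- A finite (d-1)-uniform hypergraph on vertex set Fin n, each hyperedge
-- coloured by one of d colours (Fin d).  A subset S of size d-1 is a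
-- hyperedge of colour i iff  col S ≡ just i; it is not a hyperedge iff
-- col S ≡ nothing.  Values of col on subsets of other sizes are ignored.
-- Simplicity (no repeated hyperedges) is automatic in this encoding.
record ColouredHypergraph (d : ℕ) : Set where
  field
    n   : ℕ
    col : Subset n → Maybe (Fin d)
open ColouredHypergraph public

edgeColour : ∀ {d} (H : ColouredHypergraph d) → Subset (n H) → Maybe (Fin d)
edgeColour {d} H S = if ∣ S ∣ ≡ᵇ (d ∸ 1) then col H S else nothing

finEqᵇ : ∀ {k} → Fin k → Fin k → Bool
finEqᵇ x y = toℕ x ≡ᵇ toℕ y

hasColourᵇ : ∀ {d} → Maybe (Fin d) → Fin d → Bool
hasColourᵇ nothing  i = false
hasColourᵇ (just j) i = finEqᵇ j i

isEdgeᵇ : ∀ {d} → Maybe (Fin d) → Bool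
isEdgeᵇ nothing  = false
isEdgeᵇ (just _) = true

distinctColoursᵇ : ∀ {d} → Maybe (Fin d) → Maybe (Fin d) → Bool
distinctColoursᵇ (just a) (just b) = not (finEqᵇ a b)
distinctColoursᵇ _        _        = false

colourCount : ∀ {d} (H : ColouredHypergraph d) → Fin d → ℕ
colourCount H i =
  length (filter (λ S → T? (hasColourᵇ (edgeColour H S) i)) (allSubsets (n H)))

-- S is a rainbow K^{(d-1)}_d: |S| = d, every (d-1)-subset S - x (x ∈ S)
-- is a hyperedge, and these hyperedges have pairwise distinct colours.
isRainbowᵇ : ∀ {d} (H : ColouredHypergraph d) → Subset (n H) → Bool
isRainbowᵇ {d} H S =
  (∣ S ∣ ≡ᵇ d)
  ∧ allᵇ (λ x → not (lookup S x) ∨ isEdgeᵇ (edgeColour H (S - x))) (allFin (n H))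
  ∧ allᵇ (λ x → allᵇ (λ y →
          not (lookup S x ∧ lookup S y ∧ not (finEqᵇ x y))
          ∨ distinctColoursᵇ (edgeColour H (S - x)) (edgeColour H (S - y)))
        (allFin (n H))) (allFin (n H))

rainbowCount : ∀ {d} (H : ColouredHypergraph d) → ℕ
rainbowCount H = length (filter (λ S → T? (isRainbowᵇ H S)) (allSubsets (n H)))

colourProduct : ∀ {d} (H : ColouredHypergraph d) → ℕ
colourProduct {d} H = product (map (colourCount H) (allFin d))

boundNum : ℕ → ℕ
boundNum d = if d % 2 ≡ᵇ 0 then 2 ^ (d ∸ 1) else 2 ^ d

boundDen : ℕ → ℕ
boundDen d = if d % 2 ≡ᵇ 0 then d else suc d

-- Take the complete (d − 1)-uniform hypergraph on d + 1 vertices. Its hyperedges are the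
-- complements of pairs {a, b}; colour them by an edge colouring c of K_{d+1} with d colours.
-- Then C_i counts the edges of colour i, and the d-set missing v is a rainbow K^{(d−1)}_d
-- exactly when the edges at v have distinct colours.
-- For odd d, the round-robin 1-factorisation of K_{d+1} is proper, so every vertex gives a
-- rainbow clique and every colour class is a perfect matching: T = d + 1, C_i = (d + 1)/2, and
-- T^{d−1}/∏ C_i = 2^d/(d + 1).
-- For even d, colour K_d by its round-robin factorisation with d − 1 colours and join an apex
-- to all of it in one new colour: the d old vertices are rainbow, the new colour class is a star
-- with d edges and the other classes are matchings with d/2 edges, giving 2^{d−1}/d.

module Submission where

open import Defs
open import Data.Bool using (Bool; true; false; _∧_; _∨_; not; T; if_then_else_)
open import Data.Bool.Properties using (T-∧; T-≡) renaming (_≟_ to _≟ᵇ_)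
open import Data.Fin using (Fin; zero; suc; toℕ)
open import Data.Fin.Properties using (toℕ-injective; toℕ-fromℕ<; toℕ<n; any?)
  renaming (_≟_ to _≟ᶠ_; suc-injective to sucᶠ-injective)
open import Data.Fin.Subset using (Subset; ⊤; _-_; ∣_∣)
open import Data.Fin.Subset.Properties using (∣⊤∣≡n; p─⊥≡p; p─x─y≡p─y─x)
open import Data.List using (List; []; _∷_; _++_; map; filter; length; allFin; tabulate)
open import Data.List.Properties
  using (length-map; length-++; length-removeAt′; length-tabulate; map-tabulate)
open import Data.List.Membership.Propositional using (_∈_)
open import Data.List.Membership.Propositional.Properties
  using (∈-map⁺; ∈-map⁻; ∈-++⁺ˡ; ∈-++⁺ʳ; ∈-filter⁺; ∈-filter⁻; ∈-length; ∈-allFin)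
open import Data.List.Relation.Binary.Subset.Propositional using (_⊆_)
open import Data.List.Relation.Unary.All as All using ([]; _∷_)
open import Data.List.Relation.Unary.Any using (here; there; _─_; index)
open import Data.List.Relation.Unary.Unique.Propositional using (Unique; []; _∷_)
open import Data.List.Relation.Unary.Unique.Propositional.Properties
  using (map⁺; ++⁺; filter⁺; allFin⁺)
open import Data.Maybe using (Maybe; just; nothing)
open import Data.Maybe.Properties using (just-injective)
open import Data.Nat
  using (ℕ; zero; suc; _+_; _*_; _∸_; _^_; _<_; _≤_; _≡ᵇ_; z≤n; s≤s; NonZero; _%_)
open import Data.Nat.DivMod
  using (_mod_; m%n<n; m<n⇒m%n≡m; m%n%n≡m%n; %-distribˡ-+; %-distribˡ-*; [m+n]%n≡m%n; [m+kn]%n≡m%n)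
open import Data.Nat.Properties
  using (≡⇒≡ᵇ; ≡ᵇ⇒≡; suc-injective; +-comm; +-assoc; m+[n∸m]≡n; <⇒≤; ≤-refl; m≤n⇒m≤1+n;
         *-comm; *-assoc; *-identityʳ; *-suc; *-cancelʳ-<; *-mono-≤; *-monoʳ-≤; *-monoˡ-<;
         ^-monoˡ-≤; m^n≢0; module ≤-Reasoning)
open import Data.Nat.ListAction using (product)
open import Data.Nat.Tactic.RingSolver using (solve-∀)
open import Data.Product using (Σ; ∃; ∃₂; _×_; _,_; proj₁; proj₂)
open import Data.Sum using (_⊎_; inj₁; inj₂)
open import Data.Unit using (tt)
open import Data.Vec using ([]; _∷_; lookup)
open import Data.Vec.Properties using (lookup-replicate; ∷-injectiveʳ; ≡-dec)
open import Function using (id; _∘_; Equivalence)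
open import Relation.Nullary using (¬_; Dec; yes; no; ¬?; _×-dec_; contradiction)
open import Relation.Nullary.Decidable using (T?)
open import Relation.Unary using (Decidable)
open import Relation.Binary.PropositionalEquality

private
  variable
    A B : Set
    m : ℕ
    x z : A
    xs ys : List A

∈-─⁺ : (x∈ys : x ∈ ys) → z ∈ ys → z ≢ x → z ∈ (ys ─ x∈ys)
∈-─⁺ (here refl)  (here refl) z≢x = contradiction refl z≢x
∈-─⁺ (here refl)  (there z∈)  _   = z∈
∈-─⁺ (there x∈ys) (here refl) _   = here refl
∈-─⁺ (there x∈ys) (there z∈)  z≢x = there (∈-─⁺ x∈ys z∈ z≢x)

Unique-⊆⇒length≤ : Unique xs → xs ⊆ ys → length xs ≤ length ys
Unique-⊆⇒length≤ [] _ = z≤n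
Unique-⊆⇒length≤ {ys = ys} (x∉xs ∷ xs!) xs⊆ys =
  subst (_ ≤_) (sym (length-removeAt′ ys (index x∈ys)))
    (s≤s (Unique-⊆⇒length≤ xs! λ z∈xs →
      ∈-─⁺ x∈ys (xs⊆ys (there z∈xs)) (All.lookup x∉xs z∈xs ∘ sym)))
  where x∈ys = xs⊆ys (here refl)

map⁺-on : {f : A → B} → Unique xs →
  (∀ {x y} → x ∈ xs → y ∈ xs → f x ≡ f y → x ≡ y) → Unique (map f xs)
map⁺-on []          _   = []
map⁺-on {f = f} (x∉xs ∷ xs!) inj =
  All.tabulate fx≢ ∷ map⁺-on xs! (λ x∈ y∈ → inj (there x∈) (there y∈))
  where
  fx≢ : ∀ {z} → z ∈ map f _ → f _ ≢ z
  fx≢ z∈ fx≡z with ∈-map⁻ f z∈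
  ... | y , y∈xs , refl = All.lookup x∉xs y∈xs (inj (here refl) (there y∈xs) fx≡z)

-- Subsets of Fin m

lookup-p-x-x : (p : Subset m) (x : Fin m) → lookup (p - x) x ≡ false
lookup-p-x-x (_ ∷ p) zero    = refl
lookup-p-x-x (_ ∷ p) (suc x) = lookup-p-x-x p x

lookup-p-y-x : (p : Subset m) {x y : Fin m} → x ≢ y → lookup (p - y) x ≡ lookup p x
lookup-p-y-x (_ ∷ p) {zero}  {zero}  x≢y = contradiction refl x≢y
lookup-p-y-x (_ ∷ p) {suc x} {zero}  _   = cong (λ q → lookup q x) (p─⊥≡p p)
lookup-p-y-x (_ ∷ p) {zero}  {suc y} _   = refl
lookup-p-y-x (_ ∷ p) {suc x} {suc y} x≢y = lookup-p-y-x p (x≢y ∘ cong suc)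

lookup-⊤-y-x : {x y : Fin m} → x ≢ y → lookup (⊤ - y) x ≡ true
lookup-⊤-y-x {x = x} x≢y = trans (lookup-p-y-x ⊤ x≢y) (lookup-replicate x true)

lookup-⊤-a-b-a : (a b : Fin m) → lookup (⊤ - a - b) a ≡ false
lookup-⊤-a-b-a a b with a ≟ᶠ b
... | yes refl = lookup-p-x-x (⊤ - a) a
... | no  a≢b  = trans (lookup-p-y-x (⊤ - a) a≢b) (lookup-p-x-x ⊤ a)

lookup-⊤-a-b≡false⇒ : {a b z : Fin m} → lookup (⊤ - a - b) z ≡ false → z ≡ a ⊎ z ≡ b
lookup-⊤-a-b≡false⇒ {a = a} {b} {z} eq with z ≟ᶠ a | z ≟ᶠ b
... | yes z≡a | _        = inj₁ z≡a
... | no  _   | yes z≡b  = inj₂ z≡b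
... | no  z≢a | no z≢b
  with () ← trans (sym eq) (trans (lookup-p-y-x (⊤ - a) z≢b) (lookup-⊤-y-x z≢a))

⊤-x-injective : {v w : Fin m} → ⊤ - v ≡ ⊤ - w → v ≡ w
⊤-x-injective {v = v} {w} eq with v ≟ᶠ w
... | yes v≡w = v≡w
... | no  v≢w with () ← trans (sym (lookup-⊤-y-x v≢w))
                          (trans (cong (λ p → lookup p v) (sym eq)) (lookup-p-x-x ⊤ v))

⊤-a-b-injective : {a b a′ b′ : Fin m} → ⊤ - a - b ≡ ⊤ - a′ - b′ → a ≢ b →
  (a ≡ a′ × b ≡ b′) ⊎ (a ≡ b′ × b ≡ a′)
⊤-a-b-injective {a = a} {b} eq a≢b
  with lookup-⊤-a-b≡false⇒ (subst (λ p → lookup p a ≡ false) eq (lookup-⊤-a-b-a a b))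
     | lookup-⊤-a-b≡false⇒ (subst (λ p → lookup p b ≡ false) eq (lookup-p-x-x (⊤ - a) b))
... | inj₁ a≡a′ | inj₂ b≡b′ = inj₁ (a≡a′ , b≡b′)
... | inj₂ a≡b′ | inj₁ b≡a′ = inj₂ (a≡b′ , b≡a′)
... | inj₁ a≡a′ | inj₁ b≡a′ = contradiction (trans a≡a′ (sym b≡a′)) a≢b
... | inj₂ a≡b′ | inj₂ b≡b′ = contradiction (trans a≡b′ (sym b≡b′)) a≢b

∣p∣≡1+∣p-x∣ : (p : Subset m) (x : Fin m) → lookup p x ≡ true → ∣ p ∣ ≡ suc ∣ p - x ∣
∣p∣≡1+∣p-x∣ (true  ∷ p) zero    _  = cong (suc ∘ ∣_∣) (sym (p─⊥≡p p))
∣p∣≡1+∣p-x∣ (false ∷ p) (suc x) x∈ = ∣p∣≡1+∣p-x∣ p x x∈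
∣p∣≡1+∣p-x∣ (true  ∷ p) (suc x) x∈ = cong suc (∣p∣≡1+∣p-x∣ p x x∈)

∣⊤-x∣ : (x : Fin (suc m)) → ∣ ⊤ - x ∣ ≡ m
∣⊤-x∣ {m} x =
  suc-injective (trans (sym (∣p∣≡1+∣p-x∣ ⊤ x (lookup-replicate x true))) (∣⊤∣≡n (suc m)))

∣⊤-x-y∣ : {x y : Fin (suc m)} → x ≢ y → ∣ ⊤ - x - y ∣ ≡ m ∸ 1
∣⊤-x-y∣ {m} {x} {y} x≢y =
  cong (_∸ 1) (trans (sym (∣p∣≡1+∣p-x∣ (⊤ - x) y (lookup-⊤-y-x (x≢y ∘ sym)))) (∣⊤-x∣ x))

-- Counting in a coloured hypergraph

∈-allSubsets : (S : Subset m) → S ∈ allSubsets m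
∈-allSubsets []          = here refl
∈-allSubsets (false ∷ S) = ∈-++⁺ˡ (∈-map⁺ (false ∷_) (∈-allSubsets S))
∈-allSubsets (true  ∷ S) = ∈-++⁺ʳ _ (∈-map⁺ (true ∷_) (∈-allSubsets S))

allSubsets-Unique : ∀ m → Unique (allSubsets m)
allSubsets-Unique zero    = [] ∷ []
allSubsets-Unique (suc m) =
  ++⁺ (map⁺ ∷-injectiveʳ (allSubsets-Unique m)) (map⁺ ∷-injectiveʳ (allSubsets-Unique m))
      disjoint
  where
  disjoint : ∀ {S} →
    ¬ (S ∈ map (false ∷_) (allSubsets m) × S ∈ map (true ∷_) (allSubsets m))
  disjoint (S∈₀ , S∈₁) with ∈-map⁻ (false ∷_) S∈₀ | ∈-map⁻ (true ∷_) S∈₁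
  ... | _ , _ , refl | _ , _ , ()

finEqᵇ⇒≡ : {x y : Fin m} → T (finEqᵇ x y) → x ≡ y
finEqᵇ⇒≡ {x = x} {y} = toℕ-injective ∘ ≡ᵇ⇒≡ (toℕ x) (toℕ y)

≡⇒finEqᵇ : {x y : Fin m} → x ≡ y → T (finEqᵇ x y)
≡⇒finEqᵇ {x = x} refl = ≡⇒≡ᵇ (toℕ x) (toℕ x) refl

≢⇒not-finEqᵇ : {x y : Fin m} → x ≢ y → T (not (finEqᵇ x y))
≢⇒not-finEqᵇ {x = x} {y} x≢y with finEqᵇ x y in eq
... | true  = x≢y (finEqᵇ⇒≡ (subst T (sym eq) tt))
... | false = tt

hasColourᵇ⇒≡just : {i : Fin m} (c : Maybe (Fin m)) → T (hasColourᵇ c i) → c ≡ just i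
hasColourᵇ⇒≡just (just j) j≡i = cong just (finEqᵇ⇒≡ j≡i)

T-allᵇ : (p : A → Bool) (xs : List A) → (∀ x → T (p x)) → T (allᵇ p xs)
T-allᵇ p []       all-p = tt
T-allᵇ p (x ∷ xs) all-p = Equivalence.from T-∧ (all-p x , T-allᵇ p xs all-p)

module _ {d : ℕ} (H : ColouredHypergraph d) where

  HasColour : Fin d → Subset (n H) → Set
  HasColour i S = T (hasColourᵇ (edgeColour H S) i)

  hasColour? : (i : Fin d) → Decidable (HasColour i)
  hasColour? i S = T? (hasColourᵇ (edgeColour H S) i)

  rainbow? : Decidable (T ∘ isRainbowᵇ H)
  rainbow? S = T? (isRainbowᵇ H S)

  colourClass : Fin d → List (Subset (n H))
  colourClass i = filter (hasColour? i) (allSubsets (n H))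

  colourClass-Unique : ∀ i → Unique (colourClass i)
  colourClass-Unique i = filter⁺ (hasColour? i) (allSubsets-Unique (n H))

  edgeColour-∣∣ : {S : Subset (n H)} → ∣ S ∣ ≡ d ∸ 1 → edgeColour H S ≡ col H S
  edgeColour-∣∣ {S} ∣S∣≡ =
    cong (if_then col H S else nothing) (Equivalence.to T-≡ (≡⇒≡ᵇ _ _ ∣S∣≡))

  edgeColour≡just⇒col≡just : {S : Subset (n H)} {i : Fin d} →
    edgeColour H S ≡ just i → col H S ≡ just i
  edgeColour≡just⇒col≡just {S} with ∣ S ∣ ≡ᵇ (d ∸ 1)
  ... | true  = λ eq → eq
  ... | false = λ ()

  ∈-colourClass⁻ : {S : Subset (n H)} {i : Fin d} → S ∈ colourClass i → col H S ≡ just i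
  ∈-colourClass⁻ {i = i} S∈ =
    edgeColour≡just⇒col≡just
      (hasColourᵇ⇒≡just _ (proj₂ (∈-filter⁻ (hasColour? i) {xs = allSubsets (n H)} S∈)))

  colourCount-pos : {S : Subset (n H)} {i : Fin d} → ∣ S ∣ ≡ d ∸ 1 → col H S ≡ just i →
    0 < colourCount H i
  colourCount-pos {S} {i} ∣S∣≡ S↦i =
    ∈-length (∈-filter⁺ (hasColour? i) (∈-allSubsets S) has-i)
    where
    has-i : HasColour i S
    has-i rewrite edgeColour-∣∣ {S} ∣S∣≡ | S↦i = ≡⇒finEqᵇ {x = i} refl

  rainbowCount-≥ : {Ss : List (Subset (n H))} → Unique Ss →
    (∀ {S} → S ∈ Ss → T (isRainbowᵇ H S)) → length Ss ≤ rainbowCount H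
  rainbowCount-≥ Ss! rainbow =
    Unique-⊆⇒length≤ Ss! λ {S} S∈ → ∈-filter⁺ rainbow? (∈-allSubsets S) (rainbow S∈)

  isRainbow-intro : {S : Subset (n H)} → ∣ S ∣ ≡ d → (κ : Fin (n H) → Fin d) →
    (∀ {x} → lookup S x ≡ true → edgeColour H (S - x) ≡ just (κ x)) →
    (∀ {x y} → lookup S x ≡ true → lookup S y ≡ true → κ x ≡ κ y → x ≡ y) →
    T (isRainbowᵇ H S)
  isRainbow-intro {S} ∣S∣≡d κ edge κ-injective =
    Equivalence.from T-∧ (≡⇒≡ᵇ _ _ ∣S∣≡d , Equivalence.from T-∧
      (T-allᵇ _ vertices isEdge , T-allᵇ _ vertices (T-allᵇ _ vertices ∘ distinct)))
    where
    vertices = allFin (n H)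

    isEdge : ∀ x → T (not (lookup S x) ∨ isEdgeᵇ (edgeColour H (S - x)))
    isEdge x with lookup S x in x∈S
    ... | false = tt
    ... | true rewrite edge x∈S = tt

    distinct : ∀ x y → T (not (lookup S x ∧ lookup S y ∧ not (finEqᵇ x y))
                          ∨ distinctColoursᵇ (edgeColour H (S - x)) (edgeColour H (S - y)))
    distinct x y with lookup S x in x∈S | lookup S y in y∈S | finEqᵇ x y in x≟y
    ... | false | _     | _     = tt
    ... | true  | false | _     = tt
    ... | true  | true  | true  = tt
    ... | true  | true  | false rewrite edge x∈S | edge y∈S =
      ≢⇒not-finEqᵇ λ κx≡κy → subst T x≟y (≡⇒finEqᵇ (κ-injective x∈S y∈S κx≡κy))

-- Edge colourings of complete graphs

module _ {N d : ℕ} (c : Fin N → Fin N → Fin d) where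

  ProperAt : Fin N → Set
  ProperAt v = ∀ {x y} → x ≢ v → y ≢ v → c v x ≡ c v y → x ≡ y

  IsMatching : Fin d → Set
  IsMatching i = ∀ {v x y} → x ≢ v → y ≢ v → c v x ≡ i → c v y ≡ i → x ≡ y

  IsStar : Fin d → Fin N → Set
  IsStar i w = ∀ {a b} → a ≢ b → c a b ≡ i → a ≡ w ⊎ b ≡ w

  IsUsed : Fin d → Set
  IsUsed i = ∃₂ λ a b → a ≢ b × c a b ≡ i

  proper⇒matching : (∀ v → ProperAt v) → ∀ i → IsMatching i
  proper⇒matching proper i x≢v y≢v cvx≡i cvy≡i =
    proper _ x≢v y≢v (trans cvx≡i (sym cvy≡i))

module PairComplements {d : ℕ} (c : Fin (suc d) → Fin (suc d) → Fin d)
                       (c-sym : ∀ a b → c a b ≡ c b a) where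

  IsMissingPair : Subset (suc d) → Fin (suc d) → Fin (suc d) → Set
  IsMissingPair S a b = a ≢ b × S ≡ ⊤ - a - b

  missingPair? : (S : Subset (suc d)) → Dec (∃₂ (IsMissingPair S))
  missingPair? S = any? λ a → any? λ b → ¬? (a ≟ᶠ b) ×-dec ≡-dec _≟ᵇ_ S (⊤ - a - b)

  -- The value (zero , zero) is junk: missingPair is only used on pair complements.
  missingPair : Subset (suc d) → Fin (suc d) × Fin (suc d)
  missingPair S with missingPair? S
  ... | yes (a , b , _) = a , b
  ... | no  _           = zero , zero

  pairColouring : Subset (suc d) → Maybe (Fin d)
  pairColouring S with missingPair? S
  ... | yes (a , b , _) = just (c a b)
  ... | no  _           = nothing

  H : ColouredHypergraph d
  H = record { n = suc d ; col = pairColouring }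

  pairColouring-⊤-a-b : {a b : Fin (suc d)} → a ≢ b →
    pairColouring (⊤ - a - b) ≡ just (c a b)
  pairColouring-⊤-a-b {a} {b} a≢b with missingPair? (⊤ - a - b)
  ... | no  ∄pair = contradiction (a , b , a≢b , refl) ∄pair
  ... | yes (a′ , b′ , _ , eq) with ⊤-a-b-injective eq a≢b
  ...   | inj₁ (refl , refl) = refl
  ...   | inj₂ (refl , refl) = cong just (c-sym b a)

  pairColouring≡just⇒ : {S : Subset (suc d)} {i : Fin d} → pairColouring S ≡ just i →
    IsMissingPair S (proj₁ (missingPair S)) (proj₂ (missingPair S))
      × c (proj₁ (missingPair S)) (proj₂ (missingPair S)) ≡ i
  pairColouring≡just⇒ {S} S↦i with missingPair? S
  ... | yes (a , b , missing) = missing , just-injective S↦i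

  edgeColour-⊤-a-b : {a b : Fin (suc d)} → a ≢ b → edgeColour H (⊤ - a - b) ≡ just (c a b)
  edgeColour-⊤-a-b a≢b =
    trans (edgeColour-∣∣ H (∣⊤-x-y∣ a≢b)) (pairColouring-⊤-a-b a≢b)

  ⊤-v-rainbow : {v : Fin (suc d)} → ProperAt c v → T (isRainbowᵇ H (⊤ - v))
  ⊤-v-rainbow {v} proper =
    isRainbow-intro H (∣⊤-x∣ v) (c v) edge λ x∈ y∈ → proper (≢v x∈) (≢v y∈)
    where
    ≢v : ∀ {x} → lookup (⊤ - v) x ≡ true → x ≢ v
    ≢v x∈ refl with () ← trans (sym x∈) (lookup-p-x-x ⊤ v)
    edge : ∀ {x} → lookup (⊤ - v) x ≡ true → edgeColour H (⊤ - v - x) ≡ just (c v x)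
    edge x∈ = edgeColour-⊤-a-b (≢v x∈ ∘ sym)

  rainbowCount-≥-properCentres : {R : List (Fin (suc d))} → Unique R →
    (∀ {v} → v ∈ R → ProperAt c v) → length R ≤ rainbowCount H
  rainbowCount-≥-properCentres {R} R! proper =
    subst (_≤ _) (length-map (⊤ -_) R) (rainbowCount-≥ H (map⁺ ⊤-x-injective R!) rainbow)
    where
    rainbow : ∀ {S} → S ∈ map (⊤ -_) R → T (isRainbowᵇ H S)
    rainbow S∈ with ∈-map⁻ (⊤ -_) S∈
    ... | v , v∈R , refl = ⊤-v-rainbow (proper v∈R)

  colourCount-used : {i : Fin d} → IsUsed c i → 0 < colourCount H i
  colourCount-used (a , b , a≢b , refl) =
    colourCount-pos H (∣⊤-x-y∣ a≢b) (pairColouring-⊤-a-b a≢b)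

  module _ {i : Fin d} where

    private
      E = colourClass H i

    colourCount-matching : IsMatching c i → colourCount H i * 2 ≤ suc d
    colourCount-matching matching =
      subst₂ _≤_ length-endpoints (length-tabulate id)
        (Unique-⊆⇒length≤ endpoints! λ {z} _ → ∈-allFin z)
      where
      e₁ e₂ : Subset (suc d) → Fin (suc d)
      e₁ = proj₁ ∘ missingPair
      e₂ = proj₂ ∘ missingPair

      edge-at : ∀ {S z} → S ∈ E → z ≡ e₁ S ⊎ z ≡ e₂ S →
        ∃ λ x → x ≢ z × S ≡ ⊤ - z - x × c z x ≡ i
      edge-at {S} S∈ z∈S with pairColouring≡just⇒ (∈-colourClass⁻ H S∈) | z∈S
      ... | (a≢b , S≡) , cab≡i | inj₁ refl = e₂ S , a≢b ∘ sym , S≡ , cab≡i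
      ... | (a≢b , S≡) , cab≡i | inj₂ refl =
        e₁ S , a≢b , trans S≡ (p─x─y≡p─y─x ⊤ (e₁ S) (e₂ S)) ,
        trans (c-sym (e₂ S) (e₁ S)) cab≡i

      sharing : ∀ {S S′ z} → S ∈ E → S′ ∈ E →
        z ≡ e₁ S ⊎ z ≡ e₂ S → z ≡ e₁ S′ ⊎ z ≡ e₂ S′ → S ≡ S′
      sharing S∈ S′∈ z∈S z∈S′ with edge-at S∈ z∈S | edge-at S′∈ z∈S′
      ... | x , x≢z , S≡ , czx≡i | x′ , x′≢z , S′≡ , czx′≡i
        with refl ← matching x≢z x′≢z czx≡i czx′≡i = trans S≡ (sym S′≡)

      disjoint : ∀ {z} → ¬ (z ∈ map e₁ E × z ∈ map e₂ E)
      disjoint (z∈₁ , z∈₂) with ∈-map⁻ e₁ z∈₁ | ∈-map⁻ e₂ z∈₂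
      ... | S , S∈ , z≡ | S′ , S′∈ , z≡′ with refl ← sharing S∈ S′∈ (inj₁ z≡) (inj₂ z≡′) =
        proj₁ (proj₁ (pairColouring≡just⇒ (∈-colourClass⁻ H S∈))) (trans (sym z≡) z≡′)

      endpoints! : Unique (map e₁ E ++ map e₂ E)
      endpoints! =
        ++⁺ (map⁺-on (colourClass-Unique H i) λ S∈ S′∈ eq → sharing S∈ S′∈ (inj₁ refl) (inj₁ eq))
            (map⁺-on (colourClass-Unique H i) λ S∈ S′∈ eq → sharing S∈ S′∈ (inj₂ refl) (inj₂ eq))
            disjoint

      length-endpoints : length (map e₁ E ++ map e₂ E) ≡ length E * 2
      length-endpoints = begin
        length (map e₁ E ++ map e₂ E)          ≡⟨ length-++ (map e₁ E) ⟩
        length (map e₁ E) + length (map e₂ E)  ≡⟨ cong₂ _+_ (length-map e₁ E) (length-map e₂ E) ⟩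
        length E + length E                    ≡⟨ cong (length E +_) (*-identityʳ (length E)) ⟨
        length E + length E * 1                ≡⟨ *-suc (length E) 1 ⟨
        length E * 2                           ∎
        where open ≡-Reasoning

    colourCount-star : {w : Fin (suc d)} → IsStar c i w → colourCount H i ≤ d
    colourCount-star {w} star =
      subst (_ ≤_) length-others (Unique-⊆⇒length≤ (colourClass-Unique H i) E⊆others)
      where
      others : List (Fin (suc d))
      others = allFin (suc d) ─ ∈-allFin w

      length-others : length (map (⊤ - w -_) others) ≡ d
      length-others = trans (length-map _ others) (suc-injective (trans
        (sym (length-removeAt′ (allFin (suc d)) (index (∈-allFin w)))) (length-tabulate id)))

      E⊆others : E ⊆ map (⊤ - w -_) others
      E⊆others S∈ with pairColouring≡just⇒ (∈-colourClass⁻ H S∈)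
      ... | (a≢b , S≡) , cab≡i with star a≢b cab≡i
      ...   | inj₁ refl = subst (_∈ map (⊤ - w -_) others) (sym S≡)
                            (∈-map⁺ (⊤ - w -_) (∈-─⁺ (∈-allFin w) (∈-allFin _) (a≢b ∘ sym)))
      ...   | inj₂ refl = subst (_∈ map (⊤ - w -_) others)
                            (sym (trans S≡ (p─x─y≡p─y─x ⊤ _ w)))
                            (∈-map⁺ (⊤ - w -_) (∈-─⁺ (∈-allFin w) (∈-allFin _) a≢b))

module _ {N d : ℕ} (c : Fin N → Fin N → Fin d) where

  cone : Fin (suc N) → Fin (suc N) → Fin (suc d)
  cone zero    _       = zero
  cone (suc a) zero    = zero
  cone (suc a) (suc b) = suc (c a b)

  cone-sym : (∀ a b → c a b ≡ c b a) → ∀ a b → cone a b ≡ cone b a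
  cone-sym c-sym zero    zero    = refl
  cone-sym c-sym zero    (suc b) = refl
  cone-sym c-sym (suc a) zero    = refl
  cone-sym c-sym (suc a) (suc b) = cong suc (c-sym a b)

  cone-properAt : ∀ {v} → ProperAt c v → ProperAt cone (suc v)
  cone-properAt proper {zero}  {zero}  _   _   _  = refl
  cone-properAt proper {suc x} {suc y} x≢v y≢v eq =
    cong suc (proper (x≢v ∘ cong suc) (y≢v ∘ cong suc) (sucᶠ-injective eq))

  cone-matching : ∀ {i} → IsMatching c i → IsMatching cone (suc i)
  cone-matching matching {suc v} {suc x} {suc y} x≢v y≢v refl eq =
    cong suc (matching (x≢v ∘ cong suc) (y≢v ∘ cong suc) refl (sucᶠ-injective eq))

  cone-star : IsStar cone zero zero
  cone-star {zero}  {_}     _ _ = inj₁ refl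
  cone-star {suc a} {zero}  _ _ = inj₂ refl

  cone-used : ∀ {i} → IsUsed c i → IsUsed cone (suc i)
  cone-used (a , b , a≢b , refl) = suc a , suc b , a≢b ∘ sucᶠ-injective , refl

  cone-used-zero : Fin N → IsUsed cone zero
  cone-used-zero a = zero , suc a , (λ ()) , refl

-- Residues modulo k

module _ {k : ℕ} .{{_ : NonZero k}} where

  toℕ-mod : ∀ m → toℕ (m mod k) ≡ m % k
  toℕ-mod m = toℕ-fromℕ< (m%n<n m k)

  mod-injective : (f g : ℕ → ℕ) →
    (∀ m → g (m % k) % k ≡ g m % k) → (∀ m → g (f m) % k ≡ m % k) →
    {x y : Fin k} → f (toℕ x) mod k ≡ f (toℕ y) mod k → x ≡ y
  mod-injective f g g-mod g∘f≡id {x} {y} fx≡fy = toℕ-injective (begin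
    toℕ x                      ≡⟨ m<n⇒m%n≡m (toℕ<n x) ⟨
    toℕ x % k                  ≡⟨ g∘f≡id (toℕ x) ⟨
    g (f (toℕ x)) % k          ≡⟨ g-mod (f (toℕ x)) ⟨
    g (f (toℕ x) % k) % k      ≡⟨ cong (λ r → g r % k) fx%k≡fy%k ⟩
    g (f (toℕ y) % k) % k      ≡⟨ g-mod (f (toℕ y)) ⟩
    g (f (toℕ y)) % k          ≡⟨ g∘f≡id (toℕ y) ⟩
    toℕ y % k                  ≡⟨ m<n⇒m%n≡m (toℕ<n y) ⟩
    toℕ y                      ∎)
    where
    open ≡-Reasoning
    fx%k≡fy%k : f (toℕ x) % k ≡ f (toℕ y) % k
    fx%k≡fy%k =
      trans (sym (toℕ-mod (f (toℕ x)))) (trans (cong toℕ fx≡fy) (toℕ-mod (f (toℕ y))))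

  [m%k+n]%k≡[m+n]%k : ∀ m n → (m % k + n) % k ≡ (m + n) % k
  [m%k+n]%k≡[m+n]%k m n = begin
    (m % k + n) % k          ≡⟨ %-distribˡ-+ (m % k) n k ⟩
    (m % k % k + n % k) % k  ≡⟨ cong (λ r → (r + n % k) % k) (m%n%n≡m%n m k) ⟩
    (m % k + n % k) % k      ≡⟨ %-distribˡ-+ m n k ⟨
    (m + n) % k              ∎
    where open ≡-Reasoning

  [m%k*n]%k≡[m*n]%k : ∀ m n → (m % k * n) % k ≡ (m * n) % k
  [m%k*n]%k≡[m*n]%k m n = begin
    (m % k * n) % k            ≡⟨ %-distribˡ-* (m % k) n k ⟩
    (m % k % k * (n % k)) % k  ≡⟨ cong (λ r → (r * (n % k)) % k) (m%n%n≡m%n m k) ⟩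
    (m % k * (n % k)) % k      ≡⟨ %-distribˡ-* m n k ⟨
    (m * n) % k                ∎
    where open ≡-Reasoning

  +-mod-injective : (a : Fin k) {x y : Fin k} →
    (toℕ a + toℕ x) mod k ≡ (toℕ a + toℕ y) mod k → x ≡ y
  +-mod-injective a =
    mod-injective (toℕ a +_) (_+ (k ∸ toℕ a)) (λ m → [m%k+n]%k≡[m+n]%k m (k ∸ toℕ a)) a+m-a
    where
    a+m-a : ∀ m → (toℕ a + m + (k ∸ toℕ a)) % k ≡ m % k
    a+m-a m = begin
      (toℕ a + m + (k ∸ toℕ a)) % k
        ≡⟨ cong (λ r → (r + (k ∸ toℕ a)) % k) (+-comm (toℕ a) m) ⟩
      (m + toℕ a + (k ∸ toℕ a)) % k
        ≡⟨ cong (_% k) (+-assoc m (toℕ a) (k ∸ toℕ a)) ⟩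
      (m + (toℕ a + (k ∸ toℕ a))) % k
        ≡⟨ cong (λ r → (m + r) % k) (m+[n∸m]≡n (<⇒≤ (toℕ<n a))) ⟩
      (m + k) % k                      ≡⟨ [m+n]%n≡m%n m k ⟩
      m % k                            ∎
      where open ≡-Reasoning

module RoundRobin (j : ℕ) where

  k : ℕ
  k = suc (j * 2)

  -- Vertex zero is ∞ and suc a is the residue a: the edge {∞, a} has colour 2a and {a, b} has
  -- colour a + b. The value on the diagonal is irrelevant.
  roundRobin : Fin (suc k) → Fin (suc k) → Fin k
  roundRobin zero    zero    = zero
  roundRobin zero    (suc b) = (toℕ b + toℕ b) mod k
  roundRobin (suc a) zero    = (toℕ a + toℕ a) mod k
  roundRobin (suc a) (suc b) = (toℕ a + toℕ b) mod k

  roundRobin-sym : ∀ a b → roundRobin a b ≡ roundRobin b a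
  roundRobin-sym zero    zero    = refl
  roundRobin-sym zero    (suc b) = refl
  roundRobin-sym (suc a) zero    = refl
  roundRobin-sym (suc a) (suc b) = cong (_mod k) (+-comm (toℕ a) (toℕ b))

  -- Doubling is invertible modulo the odd number k, with inverse multiplication by j + 1.
  double-mod-injective : {x y : Fin k} →
    (toℕ x + toℕ x) mod k ≡ (toℕ y + toℕ y) mod k → x ≡ y
  double-mod-injective =
    mod-injective (λ m → m + m) (_* suc j) (λ m → [m%k*n]%k≡[m*n]%k m (suc j)) halve
    where
    [m+m]*[1+j]≡m+m*k : ∀ m j → (m + m) * suc j ≡ m + m * suc (j * 2)
    [m+m]*[1+j]≡m+m*k = solve-∀
    halve : ∀ m → (m + m) * suc j % k ≡ m % k
    halve m = trans (cong (_% k) ([m+m]*[1+j]≡m+m*k m j)) ([m+kn]%n≡m%n m m k)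

  roundRobin-properAt : ∀ v → ProperAt roundRobin v
  roundRobin-properAt zero    {zero}  x≢v _   _  = contradiction refl x≢v
  roundRobin-properAt zero    {suc x} {zero}  _ y≢v _ = contradiction refl y≢v
  roundRobin-properAt zero    {suc x} {suc y} _ _   eq = cong suc (double-mod-injective eq)
  roundRobin-properAt (suc a) {zero}  {zero}  _ _   _  = refl
  roundRobin-properAt (suc a) {zero}  {suc y} _ y≢v eq =
    contradiction (cong suc (sym (+-mod-injective a eq))) y≢v
  roundRobin-properAt (suc a) {suc x} {zero}  x≢v _ eq =
    contradiction (cong suc (+-mod-injective a eq)) x≢v
  roundRobin-properAt (suc a) {suc x} {suc y} _ _   eq = cong suc (+-mod-injective a eq)

  roundRobin-used : ∀ i → IsUsed roundRobin i
  roundRobin-used zero    = zero , suc zero , (λ ()) , toℕ-injective (toℕ-mod {k} 0)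
  roundRobin-used (suc i) = suc zero , suc (suc i) , (λ ()) ,
    toℕ-injective (trans (toℕ-mod {k} (toℕ (suc i))) (m<n⇒m%n≡m (toℕ<n (suc i))))

-- The numerical bound

m*2≤1+n*2⇒m≤n : ∀ {m n} → m * 2 ≤ suc (n * 2) → m ≤ n
m*2≤1+n*2⇒m≤n {zero}              _              = z≤n
m*2≤1+n*2⇒m≤n {suc m} {suc n} (s≤s (s≤s m*2≤)) = s≤s (m*2≤1+n*2⇒m≤n m*2≤)

^-distribʳ-* : ∀ a b e → (a * b) ^ e ≡ a ^ e * b ^ e
^-distribʳ-* a b zero    = refl
^-distribʳ-* a b (suc e) =
  trans (cong (a * b *_) (^-distribʳ-* a b e)) (interchange a b (a ^ e) (b ^ e))
  where
  interchange : ∀ a b x y → a * b * (x * y) ≡ a * x * (b * y)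
  interchange = solve-∀

product-tabulate-≤ : (f : Fin m → ℕ) {b : ℕ} → (∀ i → f i ≤ b) → product (tabulate f) ≤ b ^ m
product-tabulate-≤ {zero}  f f≤b = ≤-refl
product-tabulate-≤ {suc m} f f≤b =
  *-mono-≤ (f≤b zero) (product-tabulate-≤ (f ∘ suc) (f≤b ∘ suc))

p*P<q*T^e : ∀ p q {A P T} m e → p * A < q * 2 ^ e → P ≤ A * suc m ^ e → suc m * 2 ≤ T →
  p * P < q * T ^ e
p*P<q*T^e p q {A} {P} {T} m e pA<q2^e P≤ 2m≤T = begin-strict
  p * P                    ≤⟨ *-monoʳ-≤ p P≤ ⟩
  p * (A * suc m ^ e)      ≡⟨ *-assoc p A _ ⟨
  p * A * suc m ^ e        <⟨ *-monoˡ-< (suc m ^ e) {{m^n≢0 (suc m) e}} pA<q2^e ⟩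
  q * 2 ^ e * suc m ^ e    ≡⟨ *-assoc q (2 ^ e) _ ⟩
  q * (2 ^ e * suc m ^ e)  ≡⟨ cong (q *_) (*-comm (2 ^ e) _) ⟩
  q * (suc m ^ e * 2 ^ e)  ≡⟨ cong (q *_) (^-distribʳ-* (suc m) 2 e) ⟨
  q * (suc m * 2) ^ e      ≤⟨ *-monoʳ-≤ q (^-monoˡ-≤ e 2m≤T) ⟩
  q * T ^ e                ∎
  where open ≤-Reasoning

RatioAbove : (d p q : ℕ) → Set
RatioAbove d p q = Σ (ColouredHypergraph d) λ H →
  ((i : Fin d) → 0 < colourCount H i) × (p * colourProduct H < q * rainbowCount H ^ (d ∸ 1))

-- T ^ e / ∏ C_i ≥ (2m) ^ e / (A m ^ e) = 2 ^ e / A.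
ratioAbove-fromBounds : ∀ {e A m} p q (H : ColouredHypergraph (suc e)) →
  (∀ i → 0 < colourCount H i) →
  colourCount H zero ≤ A → (∀ i → colourCount H (suc i) ≤ suc m) → suc m * 2 ≤ rainbowCount H →
  p * A < q * 2 ^ e → RatioAbove (suc e) p q
ratioAbove-fromBounds {e} {A} {m} p q H used C₀≤A C≤m T≥ pA<q2^e =
  H , used , p*P<q*T^e p q m e pA<q2^e product≤ T≥
  where
  product≤ : colourProduct H ≤ A * suc m ^ e
  product≤ = subst (_≤ A * suc m ^ e) (cong product (sym (map-tabulate id (colourCount H))))
    (*-mono-≤ C₀≤A (product-tabulate-≤ (colourCount H ∘ suc) C≤m))

odd%2 : ∀ j → suc (j * 2) % 2 ≡ 1
odd%2 j = [m+kn]%n≡m%n 1 j 2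

even%2 : ∀ j → (j * 2) % 2 ≡ 0
even%2 j = [m+kn]%n≡m%n 0 j 2

boundDen-odd : ∀ j → boundDen (suc (j * 2)) ≡ suc j * 2
boundDen-odd j rewrite odd%2 j = refl

boundNum-odd : ∀ j → boundNum (suc (j * 2)) ≡ 2 ^ suc (j * 2)
boundNum-odd j rewrite odd%2 j = refl

boundDen-even : ∀ j → boundDen (j * 2) ≡ j * 2
boundDen-even j rewrite even%2 j = refl

boundNum-even : ∀ j → boundNum (j * 2) ≡ 2 ^ (j * 2 ∸ 1)
boundNum-even j rewrite even%2 j = refl

ratioAbove-odd : ∀ j p q → p * boundDen (suc (j * 2)) < q * boundNum (suc (j * 2)) →
  RatioAbove (suc (j * 2)) p q
ratioAbove-odd j p q p·den<q·num =
  ratioAbove-fromBounds p q H (colourCount-used ∘ roundRobin-used)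
    (colourCount≤ zero) (colourCount≤ ∘ suc) rainbowCount≥ p·A<q·2^e
  where
  open RoundRobin j
  open PairComplements roundRobin roundRobin-sym

  colourCount≤ : ∀ i → colourCount H i ≤ suc j
  colourCount≤ i = m*2≤1+n*2⇒m≤n (m≤n⇒m≤1+n
    (colourCount-matching (proper⇒matching roundRobin roundRobin-properAt i)))

  rainbowCount≥ : suc j * 2 ≤ rainbowCount H
  rainbowCount≥ = subst (_≤ rainbowCount H) (length-tabulate id)
    (rainbowCount-≥-properCentres (allFin⁺ (suc k)) (λ {v} _ → roundRobin-properAt v))

  p·A<q·2^e : p * suc j < q * 2 ^ (j * 2)
  p·A<q·2^e = *-cancelʳ-< 2 (p * suc j) (q * 2 ^ (j * 2))
    (subst₂ _<_ (trans (cong (p *_) (boundDen-odd j)) (sym (*-assoc p (suc j) 2)))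
                (trans (cong (q *_) (boundNum-odd j)) (shift q (2 ^ (j * 2))))
                p·den<q·num)
    where
    shift : ∀ q x → q * (2 * x) ≡ q * x * 2
    shift = solve-∀

ratioAbove-even : ∀ j p q → p * boundDen (suc j * 2) < q * boundNum (suc j * 2) →
  RatioAbove (suc j * 2) p q
ratioAbove-even j p q p·den<q·num =
  ratioAbove-fromBounds p q H used (colourCount-star (cone-star roundRobin)) colourCount≤ rainbowCount≥
    (subst₂ _<_ (cong (p *_) (boundDen-even (suc j))) (cong (q *_) (boundNum-even (suc j)))
                p·den<q·num)
  where
  open RoundRobin j
  open PairComplements (cone roundRobin) (cone-sym roundRobin roundRobin-sym)

  used : ∀ i → 0 < colourCount H i
  used zero    = colourCount-used (cone-used-zero roundRobin zero)
  used (suc i) = colourCount-used (cone-used roundRobin (roundRobin-used i))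

  colourCount≤ : ∀ i → colourCount H (suc i) ≤ suc j
  colourCount≤ i = m*2≤1+n*2⇒m≤n (colourCount-matching
    (cone-matching roundRobin (proper⇒matching roundRobin roundRobin-properAt i)))

  rainbowCount≥ : suc j * 2 ≤ rainbowCount H
  rainbowCount≥ =
    subst (_≤ rainbowCount H) (trans (length-map suc (allFin (suc k))) (length-tabulate id))
    (rainbowCount-≥-properCentres (map⁺ sucᶠ-injective (allFin⁺ (suc k))) proper)
    where
    proper : ∀ {v} → v ∈ map suc (allFin (suc k)) → ProperAt (cone roundRobin) v
    proper v∈ with ∈-map⁻ suc v∈
    ... | v , _ , refl = cone-properAt roundRobin (roundRobin-properAt v)

even-or-odd : ∀ d → (∃ λ j → d ≡ j * 2) ⊎ (∃ λ j → d ≡ suc (j * 2))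
even-or-odd zero    = inj₁ (0 , refl)
even-or-odd (suc d) with even-or-odd d
... | inj₁ (j , refl) = inj₂ (j , refl)
... | inj₂ (j , refl) = inj₁ (suc j , refl)

theorem3p4 : (d : ℕ) → 2 ≤ d →
    (p q : ℕ) → 0 < q → p * boundDen d < q * boundNum d →
    Σ (ColouredHypergraph d) λ H →
      ((i : Fin d) → 0 < colourCount H i) ×
      (p * colourProduct H < q * rainbowCount H ^ (d ∸ 1))
theorem3p4 d 2≤d p q _ with even-or-odd d
... | inj₂ (j , refl)     = ratioAbove-odd j p q
... | inj₁ (suc j , refl) = ratioAbove-even j p q
... | inj₁ (zero , refl)  = contradiction 2≤d λ ()
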